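{- Let $G$ be a graph and let $x,y$ be distinct vertices of $G$. Then $\mu(G)\le \mu(G_{x\to y})$.
   Context: For a graph $G$, $\mu(G)=2\#(G,K_3)+\#(G,P_3)$, where $\#(G,K_3)$ is the number of 3-subsets of $V(G)$ inducing a triangle and $\#(G,P_3)$ is the number of 3-subsets inducing a path with two edges (a cherry). For distinct vertices $x,y$, let $A_{x\bar y}$ be the set of vertices other than $x,y$ adjacent to $x$ but not to $y$. The compression $G_{x\to y}$ is the graph obtained from $G$ by deleting all edges between $x$ and $A_{x\bar y}$ and adding all edges between $y$ and $A_{x\bar y}$. -}

module Defs where

open import Data.Nat using (ℕ; zero; suc; _+_; _<ᵇ_; _*_)
open import Data.Bool using (Bool; true; false; _∧_; _∨_; not; if_then_else_)
open import Data.Fin using (Fin; toℕ)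
open import Data.Fin.Properties using (_≟_)
open import Data.List using (List; []; _∷_; map; allFin; concatMap)
open import Data.Nat.ListAction using (sum)
open import Data.Product using (_×_; _,_)
open import Relation.Nullary using (does)
open import Relation.Binary.PropositionalEquality using (_≡_)

record Graph (n : ℕ) : Set where
  field
    adj   : Fin n → Fin n → Bool
    sym   : ∀ u v → adj u v ≡ adj v u
    irref : ∀ u → adj u u ≡ false
open Graph public

_==_ : ∀ {n} → Fin n → Fin n → Bool
u == v = does (u ≟ v)

b2n : Bool → ℕ
b2n true  = 1
b2n false = 0

Adj : ℕ → Set
Adj n = Fin n → Fin n → Bool

edges3 : ∀ {n} → Adj n → Fin n → Fin n → Fin n → ℕ
edges3 a i j k = b2n (a i j) + b2n (a i k) + b2n (a j k)

triples : (n : ℕ) → List (Fin n × Fin n × Fin n)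
triples n =
  concatMap (λ i → concatMap (λ j → concatMap (λ k →
      if (toℕ i <ᵇ toℕ j) ∧ (toℕ j <ᵇ toℕ k) then (i , j , k) ∷ [] else [])
    (allFin n)) (allFin n)) (allFin n)

isK3 : ∀ {n} → Adj n → Fin n × Fin n × Fin n → Bool
isK3 a (i , j , k) = a i j ∧ a i k ∧ a j k

isP3 : ∀ {n} → Adj n → Fin n × Fin n × Fin n → Bool
isP3 G (i , j , k) with edges3 G i j k
... | 2 = true
... | _ = false

numK3 : ∀ {n} → Adj n → ℕ
numK3 {n} G = sum (map (λ t → b2n (isK3 G t)) (triples n))

numP3 : ∀ {n} → Adj n → ℕ
numP3 {n} G = sum (map (λ t → b2n (isP3 G t)) (triples n))

μᵃ : ∀ {n} → Adj n → ℕ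
μᵃ a = 2 * numK3 a + numP3 a

μ : ∀ {n} → Graph n → ℕ
μ G = μᵃ (adj G)

inA : ∀ {n} → Graph n → Fin n → Fin n → Fin n → Bool
inA G x y w = not (w == x) ∧ not (w == y) ∧ adj G x w ∧ not (adj G y w)

-- adjacency of the compression G_{x→y}: delete edges x–A, add edges y–A
compAdj : ∀ {n} → Graph n → Fin n → Fin n → Fin n → Fin n → Bool
compAdj G x y u v =
  if ((u == x) ∧ inA G x y v) ∨ ((v == x) ∧ inA G x y u) then false
  else if ((u == y) ∧ inA G x y v) ∨ ((v == y) ∧ inA G x y u) then true
  else adj G u v

μComp : ∀ {n} → Graph n → Fin n → Fin n → ℕ
μComp G x y = μᵃ (compAdj G x y)

module Submission where

-- Weight each 3-set by its number of edges minus one (truncated): 2 for a triangle, 1 for a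
-- cherry, 0 otherwise, so μ is the total weight, and 6μ is the total over ordered triples of
-- distinct vertices. Pair each ordered triple t with its image τ t under the transposition
-- τ = (x y). Compression keeps every edge avoiding x and y and replaces the pair of edges
-- xw, yw by their AND at x and their OR at y. On a triple containing both x and y this leaves
-- the edge count unchanged; on a triple containing exactly one of them, the edge counts of t
-- and τ t keep their sum while the smaller one can only drop, and n ↦ n ∸ 1 is convex. So the
-- weight of every pair {t, τ t} does not decrease.

open import Defs hiding (sym)
open import Data.Bool using (Bool; true; false; _∧_; _∨_; not; if_then_else_)
open import Data.Bool.Properties using (∧-zeroʳ; ∧-identityʳ; ∨-comm)
open import Data.Empty using (⊥-elim)
open import Data.Fin using (Fin; zero; suc; toℕ)
open import Data.Fin.Properties using (_≟_)
open import Data.Fin.Permutation using (Permutation′; _⟨$⟩ʳ_; transpose)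
open import Data.List using (List; []; _∷_; _++_; map; allFin; concatMap; tabulate)
open import Data.List.Properties using (map-++)
open import Data.Nat using (ℕ; zero; suc; _+_; _*_; _∸_; _≤_; _<ᵇ_; _≡ᵇ_; z≤n; s≤s; z<s)
open import Data.Nat.ListAction using (sum)
open import Data.Nat.ListAction.Properties using (sum-++)
open import Data.Nat.Properties hiding (_≟_)
open import Data.Nat.Solver using (module +-*-Solver)
open import Data.Product using (_×_; _,_)
open import Function using (_∘_; _∘′_)
open import Function.Bundles using (Injection)
open import Function.Properties.Inverse using (↔⇒↣)
open import Relation.Binary.PropositionalEquality
open import Relation.Nullary using (does; yes; no)
open import Relation.Nullary.Decidable using (dec-true; dec-false)
open import Algebra.Properties.CommutativeSemigroup +-commutativeSemigroup using (xy∙z≈xz∙y)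
open import Algebra.Properties.Semiring.Sum +-*-semiring
  using (sum-cong-≗; ∑-distrib-+; ∑-comm; ∑-permute; *-distribˡ-sum)
  renaming (sum to ∑)
open +-*-Solver using (solve; _:+_; _:*_; _:=_; con)

-- Excess of a 3-set

b2n-∧-≤ˡ : ∀ p q → b2n (p ∧ q) ≤ b2n p
b2n-∧-≤ˡ false q     = z≤n
b2n-∧-≤ˡ true  false = z≤n
b2n-∧-≤ˡ true  true  = ≤-refl

b2n-∧-≤ʳ : ∀ p q → b2n (p ∧ q) ≤ b2n q
b2n-∧-≤ʳ false q = z≤n
b2n-∧-≤ʳ true  q = ≤-refl

b2n-∧+∨ : ∀ p q → b2n (p ∧ q) + b2n (p ∨ q) ≡ b2n p + b2n q
b2n-∧+∨ false q = refl
b2n-∧+∨ true  q = +-comm (b2n q) 1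

∸1-convex : ∀ {m n m′ n′} → m′ ≤ m → m′ ≤ n → m′ + n′ ≡ m + n →
            m ∸ 1 + (n ∸ 1) ≤ m′ ∸ 1 + (n′ ∸ 1)
∸1-convex {zero}  {n} {zero} _ _ refl = ≤-refl
∸1-convex {suc m} {n} {zero} _ _ refl = +-monoʳ-≤ m (m∸n≤m n 1)
∸1-convex {suc m} {suc n} {suc m′} {zero} (s≤s m′≤m) _ eq = ⊥-elim (<⇒≱ (m<m+n m z<s) m+1+n≤m)
  where
  m+1+n≤m : m + suc n ≤ m
  m+1+n≤m = ≤-trans (≤-reflexive (trans (sym (suc-injective eq)) (+-identityʳ m′))) m′≤m
∸1-convex {suc m} {suc n} {suc m′} {suc n′} _ _ eq =
  ≤-reflexive (sym (suc-injective (trans (sym (+-suc m′ n′)) (trans (suc-injective eq) (+-suc m n)))))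

excess : Bool → Bool → Bool → ℕ
excess p q r = b2n p + b2n q + b2n r ∸ 1

excess-comm₁₂ : ∀ p q r → excess p q r ≡ excess q p r
excess-comm₁₂ p q r = cong (λ s → s + b2n r ∸ 1) (+-comm (b2n p) (b2n q))

excess-comm₂₃ : ∀ p q r → excess p q r ≡ excess p r q
excess-comm₂₃ p q r = cong (_∸ 1) (xy∙z≈xz∙y (b2n p) (b2n q) (b2n r))

excess-∧∨ : ∀ p q r → excess p (q ∧ r) (q ∨ r) ≡ excess p q r
excess-∧∨ p q r = cong (_∸ 1) (begin
  b2n p + b2n (q ∧ r) + b2n (q ∨ r)    ≡⟨ +-assoc (b2n p) _ _ ⟩
  b2n p + (b2n (q ∧ r) + b2n (q ∨ r))  ≡⟨ cong (b2n p +_) (b2n-∧+∨ q r) ⟩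
  b2n p + (b2n q + b2n r)              ≡⟨ +-assoc (b2n p) _ _ ⟨
  b2n p + b2n q + b2n r                ∎)
  where open ≡-Reasoning

excess-∧∨-spread : ∀ p q r s t →
  excess p q t + excess r s t ≤ excess (p ∧ r) (q ∧ s) t + excess (p ∨ r) (q ∨ s) t
excess-∧∨-spread p q r s t = ∸1-convex
  (+-monoˡ-≤ (b2n t) (+-mono-≤ (b2n-∧-≤ˡ p r) (b2n-∧-≤ˡ q s)))
  (+-monoˡ-≤ (b2n t) (+-mono-≤ (b2n-∧-≤ʳ p r) (b2n-∧-≤ʳ q s)))
  (begin
    b2n (p ∧ r) + b2n (q ∧ s) + b2n t + (b2n (p ∨ r) + b2n (q ∨ s) + b2n t)
      ≡⟨ interchange (b2n (p ∧ r)) (b2n (q ∧ s)) (b2n (p ∨ r)) (b2n (q ∨ s)) (b2n t) ⟩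
    b2n (p ∧ r) + b2n (p ∨ r) + (b2n (q ∧ s) + b2n (q ∨ s)) + (b2n t + b2n t)
      ≡⟨ cong₂ (λ u v → u + v + (b2n t + b2n t)) (b2n-∧+∨ p r) (b2n-∧+∨ q s) ⟩
    b2n p + b2n r + (b2n q + b2n s) + (b2n t + b2n t)
      ≡⟨ interchange (b2n p) (b2n q) (b2n r) (b2n s) (b2n t) ⟨
    b2n p + b2n q + b2n t + (b2n r + b2n s + b2n t)
      ∎)
  where
  open ≡-Reasoning
  interchange : ∀ a b c d e → a + b + e + (c + d + e) ≡ a + c + (b + d) + (e + e)
  interchange = solve 5 (λ a b c d e → a :+ b :+ e :+ (c :+ d :+ e) := a :+ c :+ (b :+ d) :+ (e :+ e)) refl

increasing : ℕ → ℕ → ℕ → Bool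
increasing p q r = (p <ᵇ q) ∧ (q <ᵇ r)

distinctℕ : ℕ → ℕ → ℕ → Bool
distinctℕ p q r = not (p ≡ᵇ q) ∧ not (p ≡ᵇ r) ∧ not (q ≡ᵇ r)

orderings : ℕ → ℕ → ℕ → ℕ
orderings p q r = b2n (increasing p q r) + b2n (increasing p r q) + b2n (increasing q p r)
                + b2n (increasing q r p) + b2n (increasing r p q) + b2n (increasing r q p)

<ᵇ-connex : ∀ p q → b2n (p <ᵇ q) + b2n (q <ᵇ p) ≡ b2n (not (p ≡ᵇ q))
<ᵇ-connex zero    zero    = refl
<ᵇ-connex zero    (suc q) = refl
<ᵇ-connex (suc p) zero    = refl
<ᵇ-connex (suc p) (suc q) = <ᵇ-connex p q

orderings≡distinct : ∀ p q r → orderings p q r ≡ b2n (distinctℕ p q r)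
orderings≡distinct zero    zero    zero    = refl
orderings≡distinct zero    zero    (suc r) = refl
orderings≡distinct zero    (suc q) zero    = refl
orderings≡distinct (suc p) zero    zero    = refl
orderings≡distinct zero    (suc q) (suc r)
  rewrite ∧-zeroʳ (q <ᵇ r) | ∧-zeroʳ (r <ᵇ q) =
    trans (+-identityʳ _) (trans (+-identityʳ _) (trans (+-identityʳ _) (trans (+-identityʳ _)
      (<ᵇ-connex q r))))
orderings≡distinct (suc p) zero    (suc r)
  rewrite ∧-zeroʳ (p <ᵇ r) | ∧-zeroʳ (r <ᵇ p) | ∧-identityʳ (not (p ≡ᵇ r)) =
    trans (+-identityʳ _) (trans (+-identityʳ _) (<ᵇ-connex p r))
orderings≡distinct (suc p) (suc q) zero
  rewrite ∧-zeroʳ (p <ᵇ q) | ∧-zeroʳ (q <ᵇ p) | ∧-identityʳ (not (p ≡ᵇ q)) =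
    <ᵇ-connex p q
orderings≡distinct (suc p) (suc q) (suc r) = orderings≡distinct p q r

-- Sums over triples of vertices

∑-mono-≤ : ∀ {n} {f g : Fin n → ℕ} → (∀ i → f i ≤ g i) → ∑ f ≤ ∑ g
∑-mono-≤ {zero}  f≤g = z≤n
∑-mono-≤ {suc n} f≤g = +-mono-≤ (f≤g zero) (∑-mono-≤ (f≤g ∘ suc))

Vector³ : ℕ → Set
Vector³ n = Fin n → Fin n → Fin n → ℕ

infixl 6 _⊕_
_⊕_ : ∀ {n} → Vector³ n → Vector³ n → Vector³ n
(f ⊕ g) i j k = f i j k + g i j k

swap₁₂ swap₂₃ : ∀ {n} → Vector³ n → Vector³ n
swap₁₂ f i j k = f j i k
swap₂₃ f i j k = f i k j

relabel : ∀ {n} → Permutation′ n → Vector³ n → Vector³ n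
relabel π f i j k = f (π ⟨$⟩ʳ i) (π ⟨$⟩ʳ j) (π ⟨$⟩ʳ k)

sum-map-tabulate : ∀ {A : Set} {n} (f : A → ℕ) (g : Fin n → A) → sum (map f (tabulate g)) ≡ ∑ (f ∘ g)
sum-map-tabulate {n = zero}  f g = refl
sum-map-tabulate {n = suc n} f g = cong (f (g zero) +_) (sum-map-tabulate f (g ∘ suc))

sum-map-concatMap : ∀ {A B : Set} (g : B → ℕ) (h : A → List B) (xs : List A) →
                    sum (map g (concatMap h xs)) ≡ sum (map (λ z → sum (map g (h z))) xs)
sum-map-concatMap g h []       = refl
sum-map-concatMap g h (z ∷ xs) = begin
  sum (map g (h z ++ concatMap h xs))              ≡⟨ cong sum (map-++ g (h z) (concatMap h xs)) ⟩
  sum (map g (h z) ++ map g (concatMap h xs))      ≡⟨ sum-++ (map g (h z)) _ ⟩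
  sum (map g (h z)) + sum (map g (concatMap h xs))
    ≡⟨ cong (sum (map g (h z)) +_) (sum-map-concatMap g h xs) ⟩
  sum (map g (h z)) + sum (map (λ z → sum (map g (h z))) xs) ∎
  where open ≡-Reasoning

sum-concatMap-allFin : ∀ {B : Set} {n} (g : B → ℕ) (h : Fin n → List B) →
                       sum (map g (concatMap h (allFin n))) ≡ ∑ (λ i → sum (map g (h i)))
sum-concatMap-allFin {n = n} g h =
  trans (sum-map-concatMap g h (allFin n)) (sum-map-tabulate (λ i → sum (map g (h i))) (λ i → i))

sum-map-singleton-if : ∀ {B : Set} (g : B → ℕ) c t → sum (map g (if c then t ∷ [] else [])) ≡ b2n c * g t
sum-map-singleton-if g true  t = refl
sum-map-singleton-if g false t = refl

ordered : ∀ {n} → Fin n → Fin n → Fin n → Bool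
ordered i j k = increasing (toℕ i) (toℕ j) (toℕ k)

-- Opaque, so that unification compares ∑³ f with ∑³ g instead of unfolding both sums.
opaque
  ∑³ : ∀ {n} → Vector³ n → ℕ
  ∑³ f = ∑ λ i → ∑ λ j → ∑ λ k → f i j k

  ∑³-cong : ∀ {n} {f g : Vector³ n} → (∀ i j k → f i j k ≡ g i j k) → ∑³ f ≡ ∑³ g
  ∑³-cong f≡g = sum-cong-≗ λ i → sum-cong-≗ λ j → sum-cong-≗ (f≡g i j)

  ∑³-mono-≤ : ∀ {n} {f g : Vector³ n} → (∀ i j k → f i j k ≤ g i j k) → ∑³ f ≤ ∑³ g
  ∑³-mono-≤ f≤g = ∑-mono-≤ λ i → ∑-mono-≤ λ j → ∑-mono-≤ (f≤g i j)

  ∑³-distrib-⊕ : ∀ {n} (f g : Vector³ n) → ∑³ (f ⊕ g) ≡ ∑³ f + ∑³ g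
  ∑³-distrib-⊕ f g = trans
    (sum-cong-≗ λ i → trans (sum-cong-≗ λ j → ∑-distrib-+ (f i j) (g i j))
                              (∑-distrib-+ (λ j → ∑ (f i j)) (λ j → ∑ (g i j))))
    (∑-distrib-+ (λ i → ∑ λ j → ∑ (f i j)) (λ i → ∑ λ j → ∑ (g i j)))

  *-distribˡ-∑³ : ∀ {n} c (f : Vector³ n) → c * ∑³ f ≡ ∑³ (λ i j k → c * f i j k)
  *-distribˡ-∑³ c f = trans (*-distribˡ-sum c (λ i → ∑ λ j → ∑ (f i j)))
    (sum-cong-≗ λ i → trans (*-distribˡ-sum c (λ j → ∑ (f i j)))
                            (sum-cong-≗ λ j → *-distribˡ-sum c (f i j)))

  ∑³-swap₁₂ : ∀ {n} (f : Vector³ n) → ∑³ (swap₁₂ f) ≡ ∑³ f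
  ∑³-swap₁₂ f = ∑-comm λ i j → ∑ (f j i)

  ∑³-swap₂₃ : ∀ {n} (f : Vector³ n) → ∑³ (swap₂₃ f) ≡ ∑³ f
  ∑³-swap₂₃ f = sum-cong-≗ λ i → ∑-comm λ j k → f i k j

  ∑³-relabel : ∀ {n} (π : Permutation′ n) (f : Vector³ n) → ∑³ (relabel π f) ≡ ∑³ f
  ∑³-relabel {n} π f = sym (trans (∑-permute (λ i → ∑ λ j → ∑ (f i j)) π)
    (sum-cong-≗ λ i → trans (∑-permute (λ j → ∑ (f (π′ i) j)) π)
                            (sum-cong-≗ λ j → ∑-permute (f (π′ i) (π′ j)) π)))
    where
    π′ : Fin n → Fin n
    π′ = π ⟨$⟩ʳ_

  sum-triples : ∀ {n} (g : Fin n × Fin n × Fin n → ℕ) →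
                sum (map g (triples n)) ≡ ∑³ (λ i j k → b2n (ordered i j k) * g (i , j , k))
  sum-triples {n} g =
    trans (sum-concatMap-allFin g (λ i → concatMap (λ j → concatMap (pick i j) (allFin n)) (allFin n)))
      (sum-cong-≗ λ i → trans (sum-concatMap-allFin g (λ j → concatMap (pick i j) (allFin n)))
        (sum-cong-≗ λ j → trans (sum-concatMap-allFin g (pick i j))
          (sum-cong-≗ λ k → sum-map-singleton-if g (ordered i j k) (i , j , k))))
    where
    pick : Fin n → Fin n → Fin n → List (Fin n × Fin n × Fin n)
    pick i j k = if ordered i j k then (i , j , k) ∷ [] else []

∑³-orderings : ∀ {n} (H : Vector³ n) →
  ∑³ (H ⊕ swap₂₃ H ⊕ swap₁₂ H ⊕ swap₁₂ (swap₂₃ H) ⊕ swap₂₃ (swap₁₂ H) ⊕ swap₂₃ (swap₁₂ (swap₂₃ H)))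
    ≡ 6 * ∑³ H
∑³-orderings {n} H =
  plus (plus (plus (plus (plus (sym (+-identityʳ (∑³ H))) (∑³-swap₂₃ H)) (∑³-swap₁₂ H)) jki) kij) kji
  where
  plus : ∀ {m} {f g : Vector³ n} → ∑³ f ≡ m → ∑³ g ≡ ∑³ H → ∑³ (f ⊕ g) ≡ ∑³ H + m
  plus {m} {f} {g} f≡m g≡H = trans (∑³-distrib-⊕ f g) (trans (cong₂ _+_ f≡m g≡H) (+-comm m (∑³ H)))
  jki : ∑³ (swap₁₂ (swap₂₃ H)) ≡ ∑³ H
  jki = trans (∑³-swap₁₂ (swap₂₃ H)) (∑³-swap₂₃ H)
  kij : ∑³ (swap₂₃ (swap₁₂ H)) ≡ ∑³ H
  kij = trans (∑³-swap₂₃ (swap₁₂ H)) (∑³-swap₁₂ H)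
  kji : ∑³ (swap₂₃ (swap₁₂ (swap₂₃ H))) ≡ ∑³ H
  kji = trans (∑³-swap₂₃ (swap₁₂ (swap₂₃ H))) jki

half-≤ : ∀ {m n} → m + m ≤ n + n → m ≤ n
half-≤ m+m≤n+n = ≮⇒≥ λ n<m → <⇒≱ (+-mono-< n<m n<m) m+m≤n+n

∑³-mono-pairing : ∀ {n} (π : Permutation′ n) {f g : Vector³ n} →
  (∀ i j k → f i j k + relabel π f i j k ≤ g i j k + relabel π g i j k) → ∑³ f ≤ ∑³ g
∑³-mono-pairing π {f} {g} pair≤ = half-≤ (begin
  ∑³ f + ∑³ f               ≡⟨ cong (∑³ f +_) (∑³-relabel π f) ⟨
  ∑³ f + ∑³ (relabel π f)   ≡⟨ ∑³-distrib-⊕ f (relabel π f) ⟨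
  ∑³ (f ⊕ relabel π f)      ≤⟨ ∑³-mono-≤ pair≤ ⟩
  ∑³ (g ⊕ relabel π g)      ≡⟨ ∑³-distrib-⊕ g (relabel π g) ⟩
  ∑³ g + ∑³ (relabel π g)   ≡⟨ cong (∑³ g +_) (∑³-relabel π g) ⟩
  ∑³ g + ∑³ g               ∎)
  where open ≤-Reasoning

distinct : ∀ {n} → Fin n → Fin n → Fin n → Bool
distinct i j k = not (i == j) ∧ not (i == k) ∧ not (j == k)

==-toℕ : ∀ {n} (i j : Fin n) → (i == j) ≡ (toℕ i ≡ᵇ toℕ j)
==-toℕ zero    zero    = refl
==-toℕ zero    (suc j) = refl
==-toℕ (suc i) zero    = refl
==-toℕ (suc i) (suc j) = ==-toℕ i j

distinct-toℕ : ∀ {n} (i j k : Fin n) → distinct i j k ≡ distinctℕ (toℕ i) (toℕ j) (toℕ k)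
distinct-toℕ i j k = cong₂ (λ u v → not u ∧ v) (==-toℕ i j)
                       (cong₂ (λ u v → not u ∧ not v) (==-toℕ i k) (==-toℕ j k))

∑³-symmetrize : ∀ {n} (h : Vector³ n) → (∀ i j k → h j i k ≡ h i j k) → (∀ i j k → h i k j ≡ h i j k) →
  6 * ∑³ (λ i j k → b2n (ordered i j k) * h i j k) ≡ ∑³ (λ i j k → b2n (distinct i j k) * h i j k)
∑³-symmetrize {n} h h₁₂ h₂₃ = trans (sym (∑³-orderings H)) (∑³-cong sum-over-orderings)
  where
  o H : Vector³ n
  o i j k = b2n (ordered i j k)
  H i j k = o i j k * h i j k

  *-distribʳ-+⁶ : ∀ a b c d e f x → (a + b + c + d + e + f) * x ≡ a * x + b * x + c * x + d * x + e * x + f * x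
  *-distribʳ-+⁶ = solve 7 (λ a b c d e f x → (a :+ b :+ c :+ d :+ e :+ f) :* x
                            := a :* x :+ b :* x :+ c :* x :+ d :* x :+ e :* x :+ f :* x) refl

  sum-over-orderings : ∀ i j k →
    H i j k + H i k j + H j i k + H j k i + H k i j + H k j i ≡ b2n (distinct i j k) * h i j k
  sum-over-orderings i j k = begin
    o i j k * h i j k + o i k j * h i k j + o j i k * h j i k
      + o j k i * h j k i + o k i j * h k i j + o k j i * h k j i
      ≡⟨ cong₂ _+_ (cong₂ _+_ (cong₂ _+_ (cong₂ _+_ (cong₂ _+_ refl
           (cong (o i k j *_) (h₂₃ i j k)))
           (cong (o j i k *_) (h₁₂ i j k)))
           (cong (o j k i *_) (trans (h₂₃ j i k) (h₁₂ i j k))))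
           (cong (o k i j *_) (trans (h₁₂ i k j) (h₂₃ i j k))))
           (cong (o k j i *_) (trans (h₁₂ j k i) (trans (h₂₃ j i k) (h₁₂ i j k)))) ⟩
    o i j k * h i j k + o i k j * h i j k + o j i k * h i j k
      + o j k i * h i j k + o k i j * h i j k + o k j i * h i j k
      ≡⟨ *-distribʳ-+⁶ (o i j k) (o i k j) (o j i k) (o j k i) (o k i j) (o k j i) (h i j k) ⟨
    orderings (toℕ i) (toℕ j) (toℕ k) * h i j k
      ≡⟨ cong (_* h i j k) (orderings≡distinct (toℕ i) (toℕ j) (toℕ k)) ⟩
    b2n (distinctℕ (toℕ i) (toℕ j) (toℕ k)) * h i j k
      ≡⟨ cong (λ d → b2n d * h i j k) (distinct-toℕ i j k) ⟨
    b2n (distinct i j k) * h i j k ∎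
    where open ≡-Reasoning

==-relabel : ∀ {n} (π : Permutation′ n) (u v : Fin n) → ((π ⟨$⟩ʳ u) == (π ⟨$⟩ʳ v)) ≡ (u == v)
==-relabel π u v with u ≟ v
... | yes refl = dec-true (π ⟨$⟩ʳ u ≟ π ⟨$⟩ʳ u) refl
... | no u≢v   = dec-false (π ⟨$⟩ʳ u ≟ π ⟨$⟩ʳ v) (u≢v ∘ Injection.injective (↔⇒↣ π))

distinct-relabel : ∀ {n} (π : Permutation′ n) (i j k : Fin n) →
                   distinct (π ⟨$⟩ʳ i) (π ⟨$⟩ʳ j) (π ⟨$⟩ʳ k) ≡ distinct i j k
distinct-relabel π i j k = cong₂ (λ u v → not u ∧ v) (==-relabel π i j)
                             (cong₂ (λ u v → not u ∧ not v) (==-relabel π i k) (==-relabel π j k))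

distinct-weighted-≤ : ∀ {n} {a b c d : ℕ} (i j k : Fin n) → (i ≢ j → i ≢ k → j ≢ k → a + b ≤ c + d) →
  b2n (distinct i j k) * a + b2n (distinct i j k) * b ≤ b2n (distinct i j k) * c + b2n (distinct i j k) * d
distinct-weighted-≤ {a = a} {b} {c} {d} i j k a+b≤c+d with i ≟ j | i ≟ k | j ≟ k
... | yes _   | _       | _       = z≤n
... | no _    | yes _   | _       = z≤n
... | no _    | no _    | yes _   = z≤n
... | no i≢j  | no i≢k  | no j≢k
  rewrite *-identityˡ a | *-identityˡ b | *-identityˡ c | *-identityˡ d = a+b≤c+d i≢j i≢k j≢k

∑³-distinct-mono-pairing : ∀ {n} (π : Permutation′ n) (f g : Vector³ n) →
  (∀ i j k → i ≢ j → i ≢ k → j ≢ k → f i j k + relabel π f i j k ≤ g i j k + relabel π g i j k) →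
  ∑³ (λ i j k → b2n (distinct i j k) * f i j k) ≤ ∑³ (λ i j k → b2n (distinct i j k) * g i j k)
∑³-distinct-mono-pairing π f g pair≤ = ∑³-mono-pairing π λ i j k →
  subst (λ d → b2n (distinct i j k) * f i j k + b2n d * relabel π f i j k
             ≤ b2n (distinct i j k) * g i j k + b2n d * relabel π g i j k)
        (sym (distinct-relabel π i j k))
        (distinct-weighted-≤ i j k (pair≤ i j k))

-- μ as a sum over ordered triples of distinct vertices

excessOn : ∀ {n} → Adj n → Fin n → Fin n → Fin n → ℕ
excessOn b i j k = excess (b i j) (b i k) (b j k)

K3P3-weight≡excess : ∀ {n} (b : Adj n) i j k →
                     2 * b2n (isK3 b (i , j , k)) + b2n (isP3 b (i , j , k)) ≡ excessOn b i j k
K3P3-weight≡excess b i j k with b i j | b i k | b j k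
... | true  | true  | true  = refl
... | true  | true  | false = refl
... | true  | false | true  = refl
... | true  | false | false = refl
... | false | true  | true  = refl
... | false | true  | false = refl
... | false | false | true  = refl
... | false | false | false = refl

μᵃ≡∑³-ordered : ∀ {n} (b : Adj n) → μᵃ b ≡ ∑³ (λ i j k → b2n (ordered i j k) * excessOn b i j k)
μᵃ≡∑³-ordered {n} b = begin
  2 * numK3 b + numP3 b
    ≡⟨ cong₂ (λ s t → 2 * s + t) (sum-triples (b2n ∘ isK3 b)) (sum-triples (b2n ∘ isP3 b)) ⟩
  2 * ∑³ K + ∑³ P
    ≡⟨ cong (_+ ∑³ P) (*-distribˡ-∑³ 2 K) ⟩
  ∑³ (λ i j k → 2 * K i j k) + ∑³ P
    ≡⟨ ∑³-distrib-⊕ (λ i j k → 2 * K i j k) P ⟨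
  ∑³ ((λ i j k → 2 * K i j k) ⊕ P)
    ≡⟨ ∑³-cong (λ i j k → trans (factor (b2n (ordered i j k)) _ _)
                                (cong (b2n (ordered i j k) *_) (K3P3-weight≡excess b i j k))) ⟩
  ∑³ (λ i j k → b2n (ordered i j k) * excessOn b i j k) ∎
  where
  open ≡-Reasoning
  K P : Fin n → Fin n → Fin n → ℕ
  K i j k = b2n (ordered i j k) * b2n (isK3 b (i , j , k))
  P i j k = b2n (ordered i j k) * b2n (isP3 b (i , j , k))
  factor : ∀ o u v → 2 * (o * u) + o * v ≡ o * (2 * u + v)
  factor = solve 3 (λ o u v → con 2 :* (o :* u) :+ o :* v := o :* (con 2 :* u :+ v)) refl

module _ {n} (b : Adj n) (b-sym : ∀ u v → b u v ≡ b v u) where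

  excessOn-comm₁₂ : ∀ i j k → excessOn b j i k ≡ excessOn b i j k
  excessOn-comm₁₂ i j k =
    trans (cong (λ e → excess e (b j k) (b i k)) (b-sym j i)) (sym (excess-comm₂₃ (b i j) (b i k) (b j k)))

  excessOn-comm₂₃ : ∀ i j k → excessOn b i k j ≡ excessOn b i j k
  excessOn-comm₂₃ i j k =
    trans (excess-comm₁₂ (b i k) (b i j) (b k j)) (cong (excess (b i j) (b i k)) (b-sym k j))

  6μ≡∑³-distinct : 6 * μᵃ b ≡ ∑³ (λ i j k → b2n (distinct i j k) * excessOn b i j k)
  6μ≡∑³-distinct =
    trans (cong (6 *_) (μᵃ≡∑³-ordered b)) (∑³-symmetrize (excessOn b) excessOn-comm₁₂ excessOn-comm₂₃)

-- The compression G_{x→y}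

+-comm-≤ : ∀ {a b c d} → a + b ≤ c + d → b + a ≤ d + c
+-comm-≤ {a} {b} {c} {d} = subst₂ _≤_ (+-comm a b) (+-comm c d)

module Compression {n} (G : Graph n) (x y : Fin n) (x≢y : x ≢ y) where

  a c : Adj n
  a = adj G
  c = compAdj G x y

  τ : Permutation′ n
  τ = transpose x y

  private
    does-≟-refl : ∀ (u : Fin n) → does (u ≟ u) ≡ true
    does-≟-refl u = dec-true (u ≟ u) refl

    does-≟-≢ : ∀ {u v : Fin n} → u ≢ v → does (u ≟ v) ≡ false
    does-≟-≢ {u} {v} u≢v = dec-false (u ≟ v) u≢v

    y≢x : y ≢ x
    y≢x = x≢y ∘′ sym

  τ-x : τ ⟨$⟩ʳ x ≡ y
  τ-x rewrite does-≟-refl x = refl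

  τ-y : τ ⟨$⟩ʳ y ≡ x
  τ-y rewrite does-≟-≢ y≢x | does-≟-refl y = refl

  τ-other : ∀ {w} → w ≢ x → w ≢ y → τ ⟨$⟩ʳ w ≡ w
  τ-other w≢x w≢y rewrite does-≟-≢ w≢x | does-≟-≢ w≢y = refl

  compAdj-sym : ∀ u v → c u v ≡ c v u
  compAdj-sym u v
    rewrite ∨-comm ((u == x) ∧ inA G x y v) ((v == x) ∧ inA G x y u)
          | ∨-comm ((u == y) ∧ inA G x y v) ((v == y) ∧ inA G x y u)
          | Graph.sym G u v = refl

  compAdj-x : ∀ {w} → w ≢ x → w ≢ y → c x w ≡ a x w ∧ a y w
  compAdj-x {w} w≢x w≢y
    rewrite does-≟-refl x | does-≟-≢ w≢x | does-≟-≢ x≢y | does-≟-≢ w≢y with a x w | a y w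
  ... | true  | true  = refl
  ... | true  | false = refl
  ... | false | _     = refl

  compAdj-y : ∀ {w} → w ≢ x → w ≢ y → c y w ≡ a x w ∨ a y w
  compAdj-y {w} w≢x w≢y
    rewrite does-≟-refl y | does-≟-≢ w≢x | does-≟-≢ y≢x | does-≟-≢ w≢y with a x w | a y w
  ... | true  | true  = refl
  ... | true  | false = refl
  ... | false | _     = refl

  compAdj-other : ∀ {u v} → u ≢ x → u ≢ y → v ≢ x → v ≢ y → c u v ≡ a u v
  compAdj-other u≢x u≢y v≢x v≢y
    rewrite does-≟-≢ u≢x | does-≟-≢ u≢y | does-≟-≢ v≢x | does-≟-≢ v≢y = refl

  compAdj-xy : c x y ≡ a x y
  compAdj-xy rewrite does-≟-refl x | does-≟-refl y | does-≟-≢ x≢y | does-≟-≢ y≢x = refl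

  compAdj-yx : c y x ≡ a y x
  compAdj-yx = trans (compAdj-sym y x) (trans compAdj-xy (Graph.sym G x y))

  excess-pair-x : ∀ {v w} → v ≢ x → v ≢ y → w ≢ x → w ≢ y →
           excessOn a x v w + excessOn a y v w ≤ excessOn c x v w + excessOn c y v w
  excess-pair-x {v} {w} v≢x v≢y w≢x w≢y
    rewrite compAdj-x v≢x v≢y | compAdj-x w≢x w≢y | compAdj-y v≢x v≢y | compAdj-y w≢x w≢y
          | compAdj-other v≢x v≢y w≢x w≢y
    = excess-∧∨-spread (a x v) (a x w) (a y v) (a y w) (a v w)

  excess-pair-xy : ∀ {w} → w ≢ x → w ≢ y →
            excessOn a x y w + excessOn a y x w ≤ excessOn c x y w + excessOn c y x w
  excess-pair-xy {w} w≢x w≢y rewrite compAdj-xy | compAdj-yx | compAdj-x w≢x w≢y | compAdj-y w≢x w≢y =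
    ≤-reflexive (cong₂ _+_ (sym (excess-∧∨ (a x y) p q)) (begin
      excess (a y x) q p              ≡⟨ excess-comm₂₃ (a y x) p q ⟨
      excess (a y x) p q              ≡⟨ excess-∧∨ (a y x) p q ⟨
      excess (a y x) (p ∧ q) (p ∨ q)  ≡⟨ excess-comm₂₃ (a y x) (p ∧ q) (p ∨ q) ⟩
      excess (a y x) (p ∨ q) (p ∧ q)  ∎))
    where
    open ≡-Reasoning
    p q : Bool
    p = a x w
    q = a y w

  Gains : Fin n → Fin n → Fin n → Set
  Gains i j k =
    excessOn a i j k + relabel τ (excessOn a) i j k ≤ excessOn c i j k + relabel τ (excessOn c) i j k

  gains-untouched : ∀ {u v w} → u ≢ x → u ≢ y → v ≢ x → v ≢ y → w ≢ x → w ≢ y → Gains u v w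
  gains-untouched u≢x u≢y v≢x v≢y w≢x w≢y
    rewrite τ-other u≢x u≢y | τ-other v≢x v≢y | τ-other w≢x w≢y
          | compAdj-other u≢x u≢y v≢x v≢y | compAdj-other u≢x u≢y w≢x w≢y
          | compAdj-other v≢x v≢y w≢x w≢y
    = ≤-refl

  gains-x : ∀ {v w} → v ≢ x → v ≢ y → w ≢ x → w ≢ y → Gains x v w
  gains-x v≢x v≢y w≢x w≢y rewrite τ-x | τ-other v≢x v≢y | τ-other w≢x w≢y =
    excess-pair-x v≢x v≢y w≢x w≢y

  gains-y : ∀ {v w} → v ≢ x → v ≢ y → w ≢ x → w ≢ y → Gains y v w
  gains-y {v} {w} v≢x v≢y w≢x w≢y rewrite τ-y | τ-other v≢x v≢y | τ-other w≢x w≢y =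
    +-comm-≤ {excessOn a x v w} {excessOn a y v w} {excessOn c x v w} {excessOn c y v w}
             (excess-pair-x v≢x v≢y w≢x w≢y)

  gains-xy : ∀ {w} → w ≢ x → w ≢ y → Gains x y w
  gains-xy w≢x w≢y rewrite τ-x | τ-y | τ-other w≢x w≢y = excess-pair-xy w≢x w≢y

  gains-yx : ∀ {w} → w ≢ x → w ≢ y → Gains y x w
  gains-yx {w} w≢x w≢y rewrite τ-x | τ-y | τ-other w≢x w≢y =
    +-comm-≤ {excessOn a x y w} {excessOn a y x w} {excessOn c x y w} {excessOn c y x w}
             (excess-pair-xy w≢x w≢y)

  gains-swap₁₂ : ∀ {i j k} → Gains j i k → Gains i j k
  gains-swap₁₂ {i} {j} {k} = subst₂ _≤_ (swapped a (Graph.sym G)) (swapped c compAdj-sym)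
    where
    swapped : ∀ b → (∀ u v → b u v ≡ b v u) →
              excessOn b j i k + relabel τ (excessOn b) j i k ≡ excessOn b i j k + relabel τ (excessOn b) i j k
    swapped b b-sym = cong₂ _+_ (excessOn-comm₁₂ b b-sym i j k)
                                (excessOn-comm₁₂ b b-sym (τ ⟨$⟩ʳ i) (τ ⟨$⟩ʳ j) (τ ⟨$⟩ʳ k))

  gains-swap₂₃ : ∀ {i j k} → Gains i k j → Gains i j k
  gains-swap₂₃ {i} {j} {k} = subst₂ _≤_ (swapped a (Graph.sym G)) (swapped c compAdj-sym)
    where
    swapped : ∀ b → (∀ u v → b u v ≡ b v u) →
              excessOn b i k j + relabel τ (excessOn b) i k j ≡ excessOn b i j k + relabel τ (excessOn b) i j k
    swapped b b-sym = cong₂ _+_ (excessOn-comm₂₃ b b-sym i j k)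
                                (excessOn-comm₂₃ b b-sym (τ ⟨$⟩ʳ i) (τ ⟨$⟩ʳ j) (τ ⟨$⟩ʳ k))

  data Role (w : Fin n) : Set where
    is-x  : w ≡ x → Role w
    is-y  : w ≡ y → Role w
    other : w ≢ x → w ≢ y → Role w

  role : ∀ w → Role w
  role w with w ≟ x | w ≟ y
  ... | yes w≡x | _       = is-x w≡x
  ... | no w≢x  | yes w≡y = is-y w≡y
  ... | no w≢x  | no w≢y  = other w≢x w≢y

  gains : ∀ i j k → i ≢ j → i ≢ k → j ≢ k → Gains i j k
  gains i j k i≢j i≢k j≢k with role i | role j | role k
  ... | is-x refl   | is-x refl   | _           = ⊥-elim (i≢j refl)
  ... | is-x refl   | _           | is-x refl   = ⊥-elim (i≢k refl)
  ... | _           | is-x refl   | is-x refl   = ⊥-elim (j≢k refl)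
  ... | is-y refl   | is-y refl   | _           = ⊥-elim (i≢j refl)
  ... | is-y refl   | _           | is-y refl   = ⊥-elim (i≢k refl)
  ... | _           | is-y refl   | is-y refl   = ⊥-elim (j≢k refl)
  ... | other ix iy | other jx jy | other kx ky = gains-untouched ix iy jx jy kx ky
  ... | is-x refl   | other jx jy | other kx ky = gains-x jx jy kx ky
  ... | other ix iy | is-x refl   | other kx ky = gains-swap₁₂ (gains-x ix iy kx ky)
  ... | other ix iy | other jx jy | is-x refl   = gains-swap₂₃ (gains-swap₁₂ (gains-x ix iy jx jy))
  ... | is-y refl   | other jx jy | other kx ky = gains-y jx jy kx ky
  ... | other ix iy | is-y refl   | other kx ky = gains-swap₁₂ (gains-y ix iy kx ky)
  ... | other ix iy | other jx jy | is-y refl   = gains-swap₂₃ (gains-swap₁₂ (gains-y ix iy jx jy))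
  ... | is-x refl   | is-y refl   | other kx ky = gains-xy kx ky
  ... | is-y refl   | is-x refl   | other kx ky = gains-yx kx ky
  ... | is-x refl   | other jx jy | is-y refl   = gains-swap₂₃ (gains-xy jx jy)
  ... | is-y refl   | other jx jy | is-x refl   = gains-swap₂₃ (gains-yx jx jy)
  ... | other ix iy | is-x refl   | is-y refl   = gains-swap₁₂ (gains-swap₂₃ (gains-xy ix iy))
  ... | other ix iy | is-y refl   | is-x refl   = gains-swap₁₂ (gains-swap₂₃ (gains-yx ix iy))

mainTheorem4 : ∀ {n} (G : Graph n) (x y : Fin n) → x ≢ y → μ G ≤ μComp G x y
mainTheorem4 G x y x≢y = *-cancelˡ-≤ 6 (begin
  6 * μ G                                    ≡⟨ 6μ≡∑³-distinct a (Graph.sym G) ⟩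
  ∑³ (λ i j k → b2n (distinct i j k) * excessOn a i j k)
                                             ≤⟨ ∑³-distinct-mono-pairing τ (excessOn a) (excessOn c) gains ⟩
  ∑³ (λ i j k → b2n (distinct i j k) * excessOn c i j k)
                                             ≡⟨ 6μ≡∑³-distinct c compAdj-sym ⟨
  6 * μComp G x y                            ∎)
  where
  open Compression G x y x≢y
  open ≤-Reasoning
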